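{- Let $w\in S_n$. Then $w$ is equivalent to $\mathrm{id}_n=12\cdots n$ under the $S_c$-equivalence if and only if $w$ is $c$-toothed.
   Context: Fix positive integers $c\le n$. $S_m$ is the set of permutations of $\{1,\dots,m\}$ written as words. A word $w_1\cdots w_c$ (distinct integer letters) forms $u\in S_c$ if there is an integer $k$ with $w_i=u_i+k$ for all $i$. An $S_c$-hit in $w\in S_n$ is a contiguous subword of length $c$ forming some $u\in S_c$; an $S_c$-rearrangement rearranges the letters of an $S_c$-hit arbitrarily in place. The $S_c$-equivalence is the reflexive-transitive closure of $S_c$-rearrangement on $S_n$. Tail size of a nonempty word $w$ with distinct letters: least $k\ge1$ such that the first $k$ letters of $w$ are the $k$ smallest letters of $w$. Irreducible blocks: the empty word has none; otherwise, if $k$ is the tail size of $w$, $a$ the first $k$ letters and $b$ the remaining letters, then $B_1(w)=a$ and $B_i(w)=B_{i-1}(b)$ for $i>1$ whenever $B_{i-1}(b)$ exists. A permutation $w$ is $c$-toothed if (1) every irreducible block satisfies $|B_i(w)|\le c$, and (2) there is a set of consecutive indices $I=\{i_1,\dots,i_t\}$ with $\sum_{i\in I}|B_i(w)|=c$. -}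

module Defs where

open import Data.Nat using (ℕ; suc; _≤_; _<_)
open import Data.Integer as ℤ using (ℤ; +_)
open import Data.List using (List; []; _∷_; _++_; map; upTo; length; take; drop)
open import Data.Nat.ListAction using (sum)
open import Data.Empty using (⊥)
open import Data.List.Membership.Propositional using (_∈_)
open import Data.List.Relation.Unary.All using (All)
open import Data.List.Relation.Binary.Permutation.Propositional using (_↭_)
open import Data.Product using (Σ; ∃; ∃-syntax; _×_)
open import Relation.Binary.PropositionalEquality using (_≡_)
open import Relation.Binary.Construct.Closure.ReflexiveTransitive using (Star)

idWord : ℕ → List ℕ
idWord m = map suc (upTo m)

InS : ℕ → List ℕ → Set
InS m w = w ↭ idWord m

Forms : List ℕ → List ℕ → Set
Forms v u = ∃[ k ] (map +_ v ≡ map (λ x → (+ x) ℤ.+ k) u)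

IsHit : ℕ → List ℕ → Set
IsHit c v = length v ≡ c × ∃[ u ] (InS c u × Forms v u)

data Rearr (c : ℕ) : List ℕ → List ℕ → Set where
  rearr : ∀ (p h h' s : List ℕ) → IsHit c h → h' ↭ h →
          Rearr c (p ++ h ++ s) (p ++ h' ++ s)

SEquiv : ℕ → List ℕ → List ℕ → Set
SEquiv c = Star (Rearr c)

-- the first k letters of w are the k smallest letters of w
-- (every letter of w smaller than a letter of the prefix lies in the prefix)
PrefixSmallest : List ℕ → ℕ → Set
PrefixSmallest w k = ∀ x y → x ∈ take k w → y ∈ w → y < x → y ∈ take k w

IsTailSize : List ℕ → ℕ → Set
IsTailSize w k = 1 ≤ k × k ≤ length w × PrefixSmallest w k
               × (∀ j → 1 ≤ j → j < k → PrefixSmallest w j → ⊥)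

data Blocks : List ℕ → List (List ℕ) → Set where
  none : Blocks [] []
  next : ∀ (a b : List ℕ) {bs} → IsTailSize (a ++ b) (length a) →
         Blocks b bs → Blocks (a ++ b) (a ∷ bs)

Toothed : ℕ → List ℕ → Set
Toothed c w = ∃[ bs ] (Blocks w bs
  × All (λ B → length B ≤ c) bs
  × ∃[ i ] ∃[ t ] (sum (map length (take t (drop i bs))) ≡ c))

-- The irreducible blocks of a permutation w of 1 … n are ascending (each lies below everything after
-- it), so they occupy consecutive intervals of values. If w is c-toothed, the consecutive blocks of
-- total size c form an S_c-hit, which can be sorted; a sorted run of length at least c then swallows a
-- neighbouring block of size b ≤ c by sorting the window made of that block and the c − b adjacent
-- letters of the run, and repeating this block by block sorts all of w.
-- Conversely, an S_c-hit is a set of c consecutive values. In a c-toothed word no irreducible block can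
-- straddle an end of such a window, so the window is a union of consecutive blocks; rearranging it and
-- splitting it anew into blocks (of size ≤ c) gives again a c-toothed word. Since id_n is c-toothed (its
-- blocks are singletons and n ≥ c), so is every word equivalent to it.

module Submission where

open import Defs
open import Data.Nat using (ℕ; zero; suc; _+_; _∸_; _⊓_; _≤_; _<_; _≟_; z≤n; s≤s)
open import Data.Nat.Properties
open import Data.Integer as ℤ using (-[1+_])
import Data.Integer.Properties as ℤ
open import Data.List using (List; []; _∷_; _++_; [_]; map; applyUpTo; length; take; drop; concat)
open import Data.List.Properties using (++-assoc; ++-identityʳ; length-++; length-++-≤ˡ; length-++-≤ʳ; concat-++; take++drop≡id; take-all; take-map; concat-map-[_]; length-take; length-drop; ∷-injective; ∷-injectiveˡ; ∷-injectiveʳ)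
open import Data.Nat.ListAction using (sum)
open import Data.List.Membership.Propositional using (_∈_)
open import Data.List.Membership.Propositional.Properties using (∈-++⁺ˡ; ∈-++⁺ʳ; ∈-++⁻; ∈-∃++; ∈-map⁺; ∈-map⁻)
open import Data.List.Membership.DecPropositional _≟_ using (_∈?_)
open import Data.List.Relation.Binary.Subset.Propositional using (_⊆_)
open import Data.List.Relation.Binary.Subset.Propositional.Properties using (⊆-refl; ⊆-trans; ⊆-reflexive; ⊆-reflexive-↭; xs⊆xs++ys; xs⊆ys++xs)
import Data.List.Relation.Binary.Sublist.Propositional.Properties as Sublist
open import Data.List.Relation.Binary.Disjoint.Propositional using (Disjoint)
open import Data.List.Relation.Unary.Any using (here; there)
open import Data.List.Relation.Unary.All as All using (All; []; _∷_; all?)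
import Data.List.Relation.Unary.All.Properties as All
open import Data.List.Relation.Unary.Unique.Propositional using (Unique; []; _∷_)
import Data.List.Relation.Unary.Unique.Propositional.Properties as Unique
open import Data.List.Relation.Binary.Permutation.Propositional using (_↭_; ↭-refl; ↭-sym; ↭-trans; ↭-prep; ↭-reflexive; ↭⇒↭ₛ)
open import Data.List.Relation.Binary.Permutation.Propositional.Properties using (∈-resp-↭; ↭-length; ++⁺ˡ; ++⁺ʳ; ++⁺; zoom; drop-∷; shift; map⁺)
import Data.List.Relation.Binary.Permutation.Setoid.Properties as Permutationₛ
open import Data.Product using (∃; ∃₂; ∃-syntax; _×_; _,_; proj₁; proj₂)
open import Data.Sum using (_⊎_; inj₁; inj₂; [_,_]′)
open import Data.Unit using (⊤; tt)
open import Data.Empty using (⊥-elim)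
open import Relation.Nullary using (¬_; Dec; yes; no; contradiction)
open import Relation.Nullary.Decidable using (map′; _→-dec_)
import Relation.Unary as U
open import Relation.Binary.PropositionalEquality using (_≡_; refl; sym; trans; cong; cong₂; subst; subst₂; setoid; module ≡-Reasoning)
open import Relation.Binary.Construct.Closure.ReflexiveTransitive using (ε; _◅_; gmap)
open import Relation.Binary.Construct.Closure.ReflexiveTransitive.Properties using (module StarReasoning)
open import Function.Base using (_∘′_)
open import Function.Bundles using (_⇔_; mk⇔)

private
  variable
    A B C : List ℕ
    x : ℕ

-- Lists and intervals

m≤n⇒∃[o]o+m≡n : ∀ {m n} → m ≤ n → ∃ λ o → o + m ≡ n
m≤n⇒∃[o]o+m≡n m≤n = _ , m∸n+n≡m m≤n

take-++ˡ : ∀ {X : Set} j (xs ys : List X) → j ≤ length xs → take j (xs ++ ys) ≡ take j xs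
take-++ˡ zero    xs       ys _         = refl
take-++ˡ (suc j) (x ∷ xs) ys (s≤s j≤) = cong (x ∷_) (take-++ˡ j xs ys j≤)

take-length-++ : ∀ {X : Set} (xs ys : List X) → take (length xs) (xs ++ ys) ≡ xs
take-length-++ xs ys = trans (take-++ˡ (length xs) xs ys ≤-refl) (take-all (length xs) xs ≤-refl)

drop-length-++ : ∀ {X : Set} (xs ys : List X) → drop (length xs) (xs ++ ys) ≡ ys
drop-length-++ []       ys = refl
drop-length-++ (x ∷ xs) ys = drop-length-++ xs ys

take⊆ : ∀ j (A : List ℕ) → take j A ⊆ A
take⊆ j A = Sublist.Any-resp-⊆ (Sublist.take-⊆ j A)

++≡++-cases : ∀ (B R P T : List ℕ) → B ++ R ≡ P ++ T →
              (∃ λ Q → P ≡ B ++ Q × R ≡ Q ++ T) ⊎ (∃₂ λ q Q → B ≡ P ++ q ∷ Q × T ≡ q ∷ Q ++ R)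
++≡++-cases []      R P       T eq = inj₁ (P , refl , eq)
++≡++-cases (b ∷ B) R []      T eq = inj₂ (b , B , refl , sym eq)
++≡++-cases (b ∷ B) R (p ∷ P) T eq with ∷-injective eq
... | refl , eq′ with ++≡++-cases B R P T eq′
... | inj₁ (Q , P≡ , R≡)     = inj₁ (Q , cong (b ∷_) P≡ , R≡)
... | inj₂ (q , Q , B≡ , T≡) = inj₂ (q , Q , cong (b ∷_) B≡ , T≡)

concat-++₃ : ∀ (L M R : List (List ℕ)) → concat (L ++ M ++ R) ≡ concat L ++ concat M ++ concat R
concat-++₃ L M R = sym (trans (cong (concat L ++_) (concat-++ M R)) (concat-++ L (M ++ R)))

sum-map-length : ∀ (bs : List (List ℕ)) → sum (map length bs) ≡ length (concat bs)
sum-map-length []       = refl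
sum-map-length (B ∷ bs) = trans (cong (length B +_) (sum-map-length bs)) (sym (length-++ B))

length≤length-concat : ∀ {B} {bs : List (List ℕ)} → B ∈ bs → length B ≤ length (concat bs)
length≤length-concat {bs = B ∷ _}  (here refl) = length-++-≤ˡ B
length≤length-concat {bs = B′ ∷ _} (there B∈) = ≤-trans (length≤length-concat B∈) (length-++-≤ʳ _ {B′})

range : ℕ → ℕ → List ℕ
range s zero    = []
range s (suc m) = s ∷ range (suc s) m

length-range : ∀ s m → length (range s m) ≡ m
length-range s zero    = refl
length-range s (suc m) = cong suc (length-range (suc s) m)

range-++ : ∀ s i j → range s (i + j) ≡ range s i ++ range (s + i) j
range-++ s zero    j = cong (λ t → range t j) (sym (+-identityʳ s))
range-++ s (suc i) j = cong (s ∷_) (trans (range-++ (suc s) i j) (cong (λ t → range (suc s) i ++ range t j) (sym (+-suc s i))))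

∈-range⁻ : ∀ s m → x ∈ range s m → s ≤ x × x < s + m
∈-range⁻ s (suc m) (here refl) = ≤-refl , subst (s <_) (sym (+-suc s m)) (s≤s (m≤m+n s m))
∈-range⁻ {x} s (suc m) (there x∈) with ∈-range⁻ (suc s) m x∈
... | s<x , x<1+s+m = <⇒≤ s<x , subst (x <_) (sym (+-suc s m)) x<1+s+m

∈-range⁺ : ∀ s m → s ≤ x → x < s + m → x ∈ range s m
∈-range⁺ s zero    s≤x x<s+0 = contradiction (≤-trans x<s+0 (≤-trans (≤-reflexive (+-identityʳ s)) s≤x)) (n≮n _)
∈-range⁺ {x} s (suc m) s≤x x<s+m with m≤n⇒m<n∨m≡n s≤x
... | inj₂ refl = here refl
... | inj₁ s<x  = there (∈-range⁺ (suc s) m s<x (subst (x <_) (+-suc s m) x<s+m))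

map-+-range : ∀ f s m → map (_+ f) (range s m) ≡ range (s + f) m
map-+-range f s zero    = refl
map-+-range f s (suc m) = cong (s + f ∷_) (map-+-range f (suc s) m)

map-∸-range : ∀ d s m → d ≤ s → map (_∸ d) (range s m) ≡ range (s ∸ d) m
map-∸-range d s zero    d≤s = refl
map-∸-range d s (suc m) d≤s = cong (s ∸ d ∷_)
  (trans (map-∸-range d (suc s) m (m≤n⇒m≤1+n d≤s)) (cong (λ t → range t m) (+-∸-assoc 1 d≤s)))

idWord≡range : ∀ n → idWord n ≡ range 1 n
idWord≡range n = go (λ i → i) 1 n (λ _ → refl)
  where
  go : ∀ f s n → (∀ i → suc (f i) ≡ s + i) → map suc (applyUpTo f n) ≡ range s n
  go f s zero    f≗ = refl
  go f s (suc n) f≗ = cong₂ _∷_ (trans (f≗ 0) (+-identityʳ s))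
    (go (λ i → f (suc i)) (suc s) n (λ i → trans (f≗ (suc i)) (+-suc s i)))

length-idWord : ∀ n → length (idWord n) ≡ n
length-idWord n = trans (cong length (idWord≡range n)) (length-range 1 n)

Unique-++⁻ : ∀ A → Unique (A ++ B) → Unique A × Unique B × Disjoint A B
Unique-++⁻ []      u         = [] , u , λ ()
Unique-++⁻ (a ∷ A) (a∉ ∷ u) with Unique-++⁻ A u
... | uA , uB , A#B = All.++⁻ˡ A a∉ ∷ uA , uB , λ where
  (here refl , y∈B) → All.lookup (All.++⁻ʳ A a∉) y∈B refl
  (there x∈A , y∈B) → A#B (x∈A , y∈B)

Unique-resp-↭ : A ↭ B → Unique A → Unique B
Unique-resp-↭ A↭B = Permutationₛ.Unique-resp-↭ (setoid ℕ) (↭⇒↭ₛ A↭B)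

Unique-idWord : ∀ n → Unique (idWord n)
Unique-idWord n = Unique.map⁺ suc-injective (Unique.upTo⁺ n)

-- Irreducible blocks

infix 4 _≪_
_≪_ : List ℕ → List ℕ → Set
A ≪ B = ∀ {x y} → x ∈ A → y ∈ B → x < y

≪-mono : ∀ {A′ B′} → A′ ⊆ A → B′ ⊆ B → A ≪ B → A′ ≪ B′
≪-mono A′⊆A B′⊆B A≪B x∈ y∈ = A≪B (A′⊆A x∈) (B′⊆B y∈)

≪-++ˡ : A ≪ C → B ≪ C → A ++ B ≪ C
≪-++ˡ {A} A≪C B≪C x∈ y∈ = [ (λ x∈A → A≪C x∈A y∈) , (λ x∈B → B≪C x∈B y∈) ]′ (∈-++⁻ A x∈)

≪-++ʳ : A ≪ B → A ≪ C → A ≪ B ++ C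
≪-++ʳ {B = B} A≪B A≪C x∈ y∈ = [ A≪B x∈ , A≪C x∈ ]′ (∈-++⁻ B y∈)

≯⇒≪ : Disjoint A B → (∀ {x y} → x ∈ A → y ∈ B → ¬ y < x) → A ≪ B
≯⇒≪ A#B y≮x x∈ y∈ = ≤∧≢⇒< (≮⇒≥ (y≮x x∈ y∈)) (λ { refl → A#B (x∈ , y∈) })

Ascending : List (List ℕ) → Set
Ascending []       = ⊤
Ascending (B ∷ bs) = B ≪ concat bs × Ascending bs

Ascending-++⁺ : ∀ as {bs} → Ascending as → Ascending bs → concat as ≪ concat bs → Ascending (as ++ bs)
Ascending-++⁺ []       _            asc-bs _     = asc-bs
Ascending-++⁺ (A ∷ as) {bs} (A≪ , asc-as) asc-bs as≪bs =
  ≪-mono ⊆-refl (⊆-reflexive (sym (concat-++ as bs))) (≪-++ʳ A≪ (≪-mono (xs⊆xs++ys A _) ⊆-refl as≪bs)) ,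
  Ascending-++⁺ as asc-as asc-bs (≪-mono (xs⊆ys++xs _ A) ⊆-refl as≪bs)

Ascending-++⁻ : ∀ as {bs} → Ascending (as ++ bs) → Ascending as × Ascending bs × concat as ≪ concat bs
Ascending-++⁻ []       asc            = tt , asc , λ ()
Ascending-++⁻ (A ∷ as) (A≪ , asc) with Ascending-++⁻ as asc
... | asc-as , asc-bs , as≪bs =
  (≪-mono ⊆-refl (⊆-trans (xs⊆xs++ys _ _) (⊆-reflexive (concat-++ as _))) A≪ , asc-as) , asc-bs ,
  ≪-++ˡ (≪-mono ⊆-refl (⊆-trans (xs⊆ys++xs _ _) (⊆-reflexive (concat-++ as _))) A≪) as≪bs

PrefixSmallest-all : ∀ (A : List ℕ) → PrefixSmallest A (length A)
PrefixSmallest-all A _ y _ y∈A _ = subst (y ∈_) (sym (take-all (length A) A ≤-refl)) y∈A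

PrefixSmallest-++⁺ : ∀ A {B} j → A ≪ B → j ≤ length A → PrefixSmallest A j → PrefixSmallest (A ++ B) j
PrefixSmallest-++⁺ A {B} j A≪B j≤ ps x y x∈ y∈ y<x with ∈-++⁻ A y∈ | subst (x ∈_) (take-++ˡ j A B j≤) x∈
... | inj₁ y∈A | x∈′ = subst (y ∈_) (sym (take-++ˡ j A B j≤)) (ps x y x∈′ y∈A y<x)
... | inj₂ y∈B | x∈′ = contradiction (A≪B (take⊆ j A x∈′) y∈B) (<-asym y<x)

PrefixSmallest-++⁻ : ∀ A {B} j → j ≤ length A → PrefixSmallest (A ++ B) j → PrefixSmallest A j
PrefixSmallest-++⁻ A {B} j j≤ ps x y x∈ y∈ y<x =
  subst (y ∈_) (take-++ˡ j A B j≤) (ps x y (subst (x ∈_) (sym (take-++ˡ j A B j≤)) x∈) (∈-++⁺ˡ y∈) y<x)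

PrefixSmallest-split : ∀ A B → (∀ {x y} → x ∈ A → y ∈ B → ¬ y < x) → PrefixSmallest (A ++ B) (length A)
PrefixSmallest-split A B y≮x x y x∈ y∈ y<x with ∈-++⁻ A y∈
... | inj₁ y∈A = subst (y ∈_) (sym (take-length-++ A B)) y∈A
... | inj₂ y∈B = contradiction y<x (y≮x (subst (x ∈_) (take-length-++ A B) x∈) y∈B)

PrefixSmallest? : ∀ w k → Dec (PrefixSmallest w k)
PrefixSmallest? w k = map′ (λ a x y x∈ y∈ → All.lookup (All.lookup a x∈) y∈)
                           (λ ps → All.tabulate λ x∈ → All.tabulate λ y∈ → ps _ _ x∈ y∈)
  (all? (λ x → all? (λ y → (y <? x) →-dec (y ∈? take k w)) w) (take k w))

module _ {P : ℕ → Set} (P? : U.Decidable P) where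

  private
    search : ∀ b → (∃[ k ] (k < b × P k × (∀ {j} → j < k → ¬ P j))) ⊎ (∀ {j} → j < b → ¬ P j)
    search zero = inj₂ λ ()
    search (suc b) with search b
    ... | inj₁ (k , k<b , pk , below) = inj₁ (k , m<n⇒m<1+n k<b , pk , below)
    ... | inj₂ absent with P? b
    ...   | yes pb = inj₁ (b , n<1+n b , pb , absent)
    ...   | no ¬pb = inj₂ λ j<1+b → [ absent , (λ { refl → ¬pb }) ]′ (m<1+n⇒m<n∨m≡n j<1+b)

  least : ∀ m → P m → ∃[ k ] (k ≤ m × P k × (∀ {j} → j < k → ¬ P j))
  least m pm with search (suc m)
  ... | inj₁ (k , k<1+m , pk , below) = k , ≤-pred k<1+m , pk , below
  ... | inj₂ absent = contradiction pm (absent (n<1+n m))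

Irreducible : List ℕ → Set
Irreducible B = 1 ≤ length B × (∀ j → 1 ≤ j → j < length B → ¬ PrefixSmallest B j)

tail-size : ∀ x w → ∃ (IsTailSize (x ∷ w))
tail-size x w with least (λ j → PrefixSmallest? (x ∷ w) (suc j)) (length w) (PrefixSmallest-all (x ∷ w))
... | k , k≤ , ps , below = suc k , s≤s z≤n , s≤s k≤ , ps , λ { (suc j) _ j<k → below (≤-pred j<k) }

BlockDecomposition : List ℕ → List (List ℕ) → Set
BlockDecomposition w bs = concat bs ≡ w × Ascending bs × All Irreducible bs

decomposition⇒Blocks : ∀ {w} bs → BlockDecomposition w bs → Blocks w bs
decomposition⇒Blocks [] (refl , _) = none
decomposition⇒Blocks (B ∷ bs) (refl , (B≪ , asc) , (1≤|B| , irr) ∷ irrs) =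
  next B (concat bs)
    (1≤|B| , length-++-≤ˡ B , PrefixSmallest-++⁺ B (length B) B≪ ≤-refl (PrefixSmallest-all B) ,
     λ j 1≤j j<|B| ps → irr j 1≤j j<|B| (PrefixSmallest-++⁻ B j (<⇒≤ j<|B|) ps))
    (decomposition⇒Blocks bs (refl , asc , irrs))

Blocks⇒decomposition : ∀ {w bs} → Unique w → Blocks w bs → BlockDecomposition w bs
Blocks⇒decomposition u none = refl , tt , []
Blocks⇒decomposition u (next a _ {bs} (1≤|a| , _ , ps , minimal) rest) with Unique-++⁻ a u
... | _ , ub , a#b with Blocks⇒decomposition ub rest
... | refl , asc , irrs = refl , (a≪b , asc) , (1≤|a| , irr) ∷ irrs
  where
  a≪b : a ≪ concat bs
  a≪b = ≯⇒≪ a#b λ {x} {y} x∈ y∈ y<x →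
    a#b (subst (y ∈_) (take-length-++ a _) (ps x y (subst (x ∈_) (sym (take-length-++ a _)) x∈) (∈-++⁺ʳ a y∈) y<x) , y∈)
  irr : ∀ j → 1 ≤ j → j < length a → ¬ PrefixSmallest a j
  irr j 1≤j j<|a| ps-a = minimal j 1≤j j<|a| (PrefixSmallest-++⁺ a j a≪b (<⇒≤ j<|a|) ps-a)

Blocks-exist : ∀ w → ∃ (Blocks w)
Blocks-exist w = go (length w) w ≤-refl
  where
  go : ∀ n w → length w ≤ n → ∃ (Blocks w)
  go _       []      _          = [] , none
  go (suc n) (x ∷ w) (s≤s |w|≤n) with tail-size x w
  ... | suc k , tail@(_ , k<|x∷w| , _)
    with go n (drop k w) (≤-trans (≤-reflexive (length-drop k w)) (≤-trans (m∸n≤m _ k) |w|≤n))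
  ...   | bs , blocks = take (suc k) (x ∷ w) ∷ bs ,
    subst (λ v → Blocks v (take (suc k) (x ∷ w) ∷ bs)) (take++drop≡id (suc k) (x ∷ w))
      (next (take (suc k) (x ∷ w)) (drop k w) (subst₂ IsTailSize (sym (take++drop≡id (suc k) (x ∷ w))) (sym |a|≡) tail) blocks)
    where
    |a|≡ : length (take (suc k) (x ∷ w)) ≡ suc k
    |a|≡ = trans (length-take (suc k) (x ∷ w)) (m≤n⇒m⊓n≡m k<|x∷w|)

decomposition-++ : ∀ {as bs} → BlockDecomposition A as → BlockDecomposition B bs → A ≪ B →
                   BlockDecomposition (A ++ B) (as ++ bs)
decomposition-++ {as = as} (refl , asc-as , irr-as) (refl , asc-bs , irr-bs) A≪B =
  sym (concat-++ as _) , Ascending-++⁺ as asc-as asc-bs A≪B , All.++⁺ irr-as irr-bs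

irreducible⇒¬≪ : ∀ {x X y Y} → Irreducible ((x ∷ X) ++ y ∷ Y) → ¬ (x ∷ X ≪ y ∷ Y)
irreducible⇒¬≪ {x} {X} {y} {Y} (_ , minimal) X≪Y =
  minimal (length (x ∷ X)) (s≤s z≤n) |X|<|B| (PrefixSmallest-split (x ∷ X) (y ∷ Y) λ x∈ y∈ → <⇒≯ (X≪Y x∈ y∈))
  where
  |X|<|B| : length (x ∷ X) < length ((x ∷ X) ++ y ∷ Y)
  |X|<|B| = subst (length (x ∷ X) <_) (sym (length-++ (x ∷ X))) (m<m+n _ (s≤s z≤n))

-- The hypothesis says that a block straddling the cut would have its part before the cut below its
-- part after it, which irreducibility forbids; so the cut falls between two blocks.
decomposition-cut : ∀ bs {P T} → BlockDecomposition (P ++ T) bs →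
  (∀ {x X y Y R} → (x ∷ X) ++ y ∷ Y ∈ bs → (x ∷ X) ++ y ∷ Y ≪ R → x ∷ X ⊆ P → (y ∷ Y) ++ R ≡ T →
                   x ∷ X ≪ y ∷ Y) →
  ∃₂ λ bs₁ bs₂ → bs ≡ bs₁ ++ bs₂ × BlockDecomposition P bs₁ × BlockDecomposition T bs₂ × P ≪ T
decomposition-cut bs {[]} D _ = [] , bs , refl , (refl , tt , []) , D , λ ()
decomposition-cut (B ∷ bs) {p ∷ P} {T} (eq , (B≪ , asc) , irr ∷ irrs) no-straddle
  with ++≡++-cases B (concat bs) (p ∷ P) T eq
... | inj₂ (y , Y , refl , T≡) = ⊥-elim (irreducible⇒¬≪ irr (no-straddle (here refl) B≪ ⊆-refl (sym T≡)))
... | inj₁ (Q , P≡ , bs≡) with decomposition-cut bs (bs≡ , asc , irrs) (λ X∈ X≪R X⊆Q eq′ →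
       no-straddle (there X∈) X≪R (⊆-trans X⊆Q (⊆-trans (xs⊆ys++xs Q B) (⊆-reflexive (sym P≡)))) eq′)
... | bs₁ , bs₂ , refl , (refl , asc₁ , irr₁) , D₂ , Q≪T =
  B ∷ bs₁ , bs₂ , refl , (sym P≡ , (≪-mono ⊆-refl (⊆-trans (xs⊆xs++ys _ T) bs⊇) B≪ , asc₁) , irr ∷ irr₁) , D₂ ,
  ≪-mono (⊆-reflexive P≡) ⊆-refl (≪-++ˡ (≪-mono ⊆-refl (⊆-trans (xs⊆ys++xs T _) bs⊇) B≪) Q≪T)
  where
  bs⊇ : concat bs₁ ++ T ⊆ concat (bs₁ ++ bs₂)
  bs⊇ = ⊆-reflexive (sym bs≡)

cut-between : ∀ bs {P T} → P ≪ T → BlockDecomposition (P ++ T) bs →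
              ∃₂ λ bs₁ bs₂ → bs ≡ bs₁ ++ bs₂ × BlockDecomposition P bs₁ × BlockDecomposition T bs₂
cut-between bs P≪T D with decomposition-cut bs D (λ {_} {_} {_} {_} {R} _ _ X⊆P eq →
                            ≪-mono X⊆P (⊆-trans (xs⊆xs++ys _ R) (⊆-reflexive eq)) P≪T)
... | bs₁ , bs₂ , bs≡ , D₁ , D₂ , _ = bs₁ , bs₂ , bs≡ , D₁ , D₂

-- Hits and convexity

Rearr-prefix : ∀ {c} X {u v} → Rearr c u v → Rearr c (X ++ u) (X ++ v)
Rearr-prefix X (rearr p h h′ s hit h′↭h) =
  subst₂ (Rearr _) (++-assoc X p (h ++ s)) (++-assoc X p (h′ ++ s)) (rearr (X ++ p) h h′ s hit h′↭h)

SEquiv-prefix : ∀ {c} X {u v} → SEquiv c u v → SEquiv c (X ++ u) (X ++ v)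
SEquiv-prefix X = gmap (X ++_) (Rearr-prefix X)

Unique-resp-Rearr : ∀ {c u v} → Rearr c u v → Unique u → Unique v
Unique-resp-Rearr (rearr p h h′ s _ h′↭h) = Unique-resp-↭ (zoom p (↭-sym h′↭h))

-- The hit forms u = W − d with offset k = + d.
range-hit : ∀ {c} d {W} → W ↭ range (suc d) c → IsHit c W
range-hit {c} d {W} W↭ =
  trans (↭-length W↭) (length-range _ c) , map (_∸ d) W , u↭id , ℤ.+ d ,
  shift-back W (λ x∈ → <⇒≤ (proj₁ (∈-range⁻ _ c (∈-resp-↭ W↭ x∈))))
  where
  u↭id : map (_∸ d) W ↭ idWord c
  u↭id = ↭-trans (map⁺ (_∸ d) W↭) (↭-reflexive (trans (map-∸-range d (suc d) c (n≤1+n d))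
           (trans (cong (λ t → range t c) (m+n∸n≡m 1 d)) (sym (idWord≡range c)))))
  shift-back : ∀ V → (∀ {x} → x ∈ V → d ≤ x) → map ℤ.+_ V ≡ map (λ x → ℤ.+ x ℤ.+ ℤ.+ d) (map (_∸ d) V)
  shift-back []      _   = refl
  shift-back (x ∷ V) d≤ =
    cong₂ _∷_ (cong ℤ.+_ (sym (m∸n+n≡m (d≤ (here refl))))) (shift-back V (λ x∈ → d≤ (there x∈)))

sort-window : ∀ {c} d P {W} S → W ↭ range (suc d) c → Rearr c (P ++ W ++ S) (P ++ range (suc d) c ++ S)
sort-window d P S W↭ = rearr P _ _ S (range-hit d W↭) (↭-sym W↭)

Convex : List ℕ → Set
Convex H = ∀ {x y z} → x ∈ H → z ∈ H → x ≤ y → y ≤ z → y ∈ H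

Convex-range : ∀ s m → Convex (range s m)
Convex-range s m x∈ z∈ x≤y y≤z =
  ∈-range⁺ s m (≤-trans (proj₁ (∈-range⁻ s m x∈)) x≤y) (≤-<-trans y≤z (proj₂ (∈-range⁻ s m z∈)))

Convex-resp-↭ : A ↭ B → Convex A → Convex B
Convex-resp-↭ A↭B convex x∈ z∈ x≤y y≤z =
  ∈-resp-↭ A↭B (convex (∈-resp-↭ (↭-sym A↭B) x∈) (∈-resp-↭ (↭-sym A↭B) z∈) x≤y y≤z)

Convex-map-+⁻ : ∀ e → Convex (map (_+ e) A) → Convex A
Convex-map-+⁻ {A} e convex {y = y} x∈ z∈ x≤y y≤z
  with ∈-map⁻ (_+ e) (convex (∈-map⁺ (_+ e) x∈) (∈-map⁺ (_+ e) z∈) (+-monoˡ-≤ e x≤y) (+-monoˡ-≤ e y≤z))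
... | y′ , y′∈ , y+e≡y′+e = subst (_∈ A) (sym (+-cancelʳ-≡ e y y′ y+e≡y′+e)) y′∈

ℤ-offset : ∀ k → ∃₂ λ e f → ∀ {a b} → ℤ.+ a ≡ ℤ.+ b ℤ.+ k → a + e ≡ b + f
ℤ-offset k with cancel-sign k
  where
  cancel-sign : ∀ k → ∃₂ λ e f → k ℤ.+ ℤ.+ e ≡ ℤ.+ f
  cancel-sign (ℤ.+ d)  = 0 , d , ℤ.+-identityʳ (ℤ.+ d)
  cancel-sign -[1+ d ] = suc d , 0 , ℤ.+-inverseˡ (ℤ.+ suc d)
... | e , f , k+e≡f = e , f , λ {a} {b} a≡b+k → ℤ.+-injective (begin
  ℤ.+ (a + e)                 ≡⟨ ℤ.pos-+ a e ⟩
  ℤ.+ a ℤ.+ ℤ.+ e             ≡⟨ cong (λ i → i ℤ.+ ℤ.+ e) a≡b+k ⟩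
  (ℤ.+ b ℤ.+ k) ℤ.+ ℤ.+ e     ≡⟨ ℤ.+-assoc (ℤ.+ b) k (ℤ.+ e) ⟩
  ℤ.+ b ℤ.+ (k ℤ.+ ℤ.+ e)     ≡⟨ cong (λ j → ℤ.+ b ℤ.+ j) k+e≡f ⟩
  ℤ.+ b ℤ.+ ℤ.+ f             ≡⟨ sym (ℤ.pos-+ b f) ⟩
  ℤ.+ (b + f)                 ∎)
  where open ≡-Reasoning

Forms⇒offset : ∀ {v u} → Forms v u → ∃₂ λ e f → map (_+ e) v ≡ map (_+ f) u
Forms⇒offset (k , eq) with ℤ-offset k
... | e , f , offset = e , f , go _ _ eq
  where
  go : ∀ v u → map ℤ.+_ v ≡ map (λ x → ℤ.+ x ℤ.+ k) u → map (_+ e) v ≡ map (_+ f) u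
  go []      []      _  = refl
  go (a ∷ v) (b ∷ u) eq = cong₂ _∷_ (offset (∷-injectiveˡ eq)) (go v u (∷-injectiveʳ eq))

hit-convex : ∀ {c H} → IsHit c H → Convex H
hit-convex {c} {H} (_ , u , u↭id , forms) with Forms⇒offset forms
... | e , f , H+e≡u+f = Convex-map-+⁻ e (subst Convex (sym H+e≡u+f) (Convex-resp-↭ (↭-sym u+f↭) (Convex-range (1 + f) c)))
  where
  u+f↭ : map (_+ f) u ↭ range (1 + f) c
  u+f↭ = ↭-trans (map⁺ (_+ f) u↭id) (↭-reflexive (trans (cong (map (_+ f)) (idWord≡range c)) (map-+-range f 1 c)))

-- Sorting a toothed permutation

-- Recursion on the length: the least letter s of the range must lie in A, so removing it from A
-- and from the range reduces to the same situation one letter shorter.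
↭-range-split : ∀ A {C} s → A ≪ C → A ++ C ↭ range s (length A + length C) →
                A ↭ range s (length A) × C ↭ range (s + length A) (length C)
↭-range-split A s = go (length A) A s refl
  where
  go : ∀ k A {C} s → length A ≡ k → A ≪ C → A ++ C ↭ range s (length A + length C) →
       A ↭ range s (length A) × C ↭ range (s + length A) (length C)
  go _ [] {C} s _ _ AC↭ = ↭-refl , subst (λ t → C ↭ range t (length C)) (sym (+-identityʳ s)) AC↭
  go (suc k) (a ∷ A) {C} s |A|≡ A≪C AC↭ with ∈-++⁻ (a ∷ A) (∈-resp-↭ (↭-sym AC↭) (here refl))
  ... | inj₂ s∈C = contradiction (A≪C (here refl) s∈C) (≤⇒≯ (proj₁ (∈-range⁻ s _ (∈-resp-↭ AC↭ (here refl)))))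
  ... | inj₁ s∈A with ∈-∃++ s∈A
  ... | P , Q , a∷A≡ = ↭-trans A↭ (↭-prep s (subst (λ l → P ++ Q ↭ range (suc s) l) |A′|≡|A| A′↭)) ,
                       subst (λ t → C ↭ range t (length C)) start≡ C↭
    where
    A↭ : a ∷ A ↭ s ∷ (P ++ Q)
    A↭ = subst (_↭ s ∷ (P ++ Q)) (sym a∷A≡) (shift s P Q)
    |A′|≡|A| : length (P ++ Q) ≡ length A
    |A′|≡|A| = suc-injective (sym (↭-length A↭))
    A′C↭ : (P ++ Q) ++ C ↭ range (suc s) (length (P ++ Q) + length C)
    A′C↭ = drop-∷ (↭-trans (↭-sym (++⁺ʳ C A↭))
                           (subst (λ l → (a ∷ A) ++ C ↭ range s (suc l + length C)) (sym |A′|≡|A|) AC↭))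
    start≡ : suc s + length (P ++ Q) ≡ s + suc (length A)
    start≡ = trans (cong (λ l → suc (s + l)) |A′|≡|A|) (sym (+-suc s (length A)))
    IH = go k (P ++ Q) (suc s) (trans |A′|≡|A| (suc-injective |A|≡))
            (≪-mono (λ x∈ → ∈-resp-↭ (↭-sym A↭) (there x∈)) ⊆-refl A≪C) A′C↭
    A′↭ = proj₁ IH
    C↭ = proj₂ IH

Consecutive : ℕ → List (List ℕ) → Set
Consecutive s []       = ⊤
Consecutive s (B ∷ bs) = B ↭ range s (length B) × Consecutive (s + length B) bs

ascending⇒consecutive : ∀ bs s → Ascending bs → concat bs ↭ range s (length (concat bs)) → Consecutive s bs
ascending⇒consecutive []       s _            _  = tt
ascending⇒consecutive (B ∷ bs) s (B≪ , asc) B++↭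
  with ↭-range-split B s B≪ (subst (λ l → B ++ concat bs ↭ range s l) (length-++ B) B++↭)
... | B↭ , bs↭ = B↭ , ascending⇒consecutive bs (s + length B) asc bs↭

consecutive-++⁻ : ∀ as {bs} s → Consecutive s (as ++ bs) → Consecutive s as × Consecutive (s + length (concat as)) bs
consecutive-++⁻ []       {bs} s cons         = tt , subst (λ t → Consecutive t bs) (sym (+-identityʳ s)) cons
consecutive-++⁻ (A ∷ as) {bs} s (A↭ , cons) with consecutive-++⁻ as (s + length A) cons
... | cons-as , cons-bs = (A↭ , cons-as) , subst (λ t → Consecutive t bs) start≡ cons-bs
  where
  start≡ : s + length A + length (concat as) ≡ s + length (A ++ concat as)
  start≡ = trans (+-assoc s (length A) _) (cong (s +_) (sym (length-++ A)))

consecutive⇒↭ : ∀ bs s → Consecutive s bs → concat bs ↭ range s (length (concat bs))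
consecutive⇒↭ []       s _            = ↭-refl
consecutive⇒↭ (B ∷ bs) s (B↭ , cons) = ↭-trans (++⁺ B↭ (consecutive⇒↭ bs (s + length B) cons))
  (↭-reflexive (trans (sym (range-++ s (length B) _)) (cong (range s) (sym (length-++ B)))))

-- The window is the last c − b letters of the sorted run followed by the block B.
absorb-right : ∀ {c m b B} s T → b ≤ c → c ≤ m → B ↭ range (suc s + m) b →
               Rearr c (range (suc s) m ++ B ++ T) (range (suc s) (m + b) ++ T)
absorb-right {b = b} {B} s T b≤c c≤m B↭ with m≤n⇒∃[o]o+m≡n b≤c
... | e , refl with m≤n⇒∃[o]o+m≡n (≤-trans (m≤m+n e b) c≤m)
... | m₀ , refl = subst₂ (Rearr (e + b)) before after (sort-window (s + m₀) (range (suc s) m₀) T window)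
  where
  open ≡-Reasoning
  window : range (suc s + m₀) e ++ B ↭ range (suc s + m₀) (e + b)
  window = ↭-trans (++⁺ˡ (range (suc s + m₀) e) (subst (λ t → B ↭ range t b) (sym (+-assoc (suc s) m₀ e)) B↭))
                   (↭-reflexive (sym (range-++ (suc s + m₀) e b)))
  before : range (suc s) m₀ ++ (range (suc s + m₀) e ++ B) ++ T ≡ range (suc s) (m₀ + e) ++ B ++ T
  before = begin
    range (suc s) m₀ ++ (range (suc s + m₀) e ++ B) ++ T   ≡⟨ cong (range (suc s) m₀ ++_) (++-assoc (range (suc s + m₀) e) B T) ⟩
    range (suc s) m₀ ++ range (suc s + m₀) e ++ B ++ T     ≡⟨ sym (++-assoc (range (suc s) m₀) _ _) ⟩
    (range (suc s) m₀ ++ range (suc s + m₀) e) ++ B ++ T   ≡⟨ cong (_++ B ++ T) (sym (range-++ (suc s) m₀ e)) ⟩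
    range (suc s) (m₀ + e) ++ B ++ T                       ∎
  after : range (suc s) m₀ ++ range (suc s + m₀) (e + b) ++ T ≡ range (suc s) (m₀ + e + b) ++ T
  after = begin
    range (suc s) m₀ ++ range (suc s + m₀) (e + b) ++ T    ≡⟨ sym (++-assoc (range (suc s) m₀) _ T) ⟩
    (range (suc s) m₀ ++ range (suc s + m₀) (e + b)) ++ T  ≡⟨ cong (_++ T) (sym (range-++ (suc s) m₀ (e + b))) ⟩
    range (suc s) (m₀ + (e + b)) ++ T                      ≡⟨ cong (λ l → range (suc s) l ++ T) (sym (+-assoc m₀ e b)) ⟩
    range (suc s) (m₀ + e + b) ++ T                        ∎

-- The window is the block B followed by the first c − b letters of the sorted run.
absorb-left : ∀ {c m b B} s → b ≤ c → c ≤ m → B ↭ range (suc s) b →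
              Rearr c (B ++ range (suc s + b) m) (range (suc s) (b + m))
absorb-left {b = b} {B} s b≤c c≤m B↭ with m≤n⇒∃[o]m+o≡n b≤c
... | e , refl with m≤n⇒∃[o]m+o≡n (≤-trans (m≤n+m e b) c≤m)
... | m₁ , refl = subst₂ (Rearr (b + e)) before after (sort-window s [] (range (suc s + b + e) m₁) window)
  where
  open ≡-Reasoning
  window : B ++ range (suc s + b) e ↭ range (suc s) (b + e)
  window = ↭-trans (++⁺ʳ (range (suc s + b) e) B↭) (↭-reflexive (sym (range-++ (suc s) b e)))
  before : (B ++ range (suc s + b) e) ++ range (suc s + b + e) m₁ ≡ B ++ range (suc s + b) (e + m₁)
  before = trans (++-assoc B _ _) (cong (B ++_) (sym (range-++ (suc s + b) e m₁)))
  after : range (suc s) (b + e) ++ range (suc s + b + e) m₁ ≡ range (suc s) (b + (e + m₁))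
  after = begin
    range (suc s) (b + e) ++ range (suc s + b + e) m₁      ≡⟨ cong (λ t → range (suc s) (b + e) ++ range t m₁) (+-assoc (suc s) b e) ⟩
    range (suc s) (b + e) ++ range (suc s + (b + e)) m₁    ≡⟨ sym (range-++ (suc s) (b + e) m₁) ⟩
    range (suc s) (b + e + m₁)                             ≡⟨ cong (range (suc s)) (+-assoc b e m₁) ⟩
    range (suc s) (b + (e + m₁))                           ∎

grow-right : ∀ {c} R s m → c ≤ m → Consecutive (suc s + m) R → All (λ B → length B ≤ c) R →
             SEquiv c (range (suc s) m ++ concat R) (range (suc s) (m + length (concat R)))
grow-right {c} [] s m _ _ _ = begin
  range (suc s) m ++ []          ≡⟨ ++-identityʳ _ ⟩
  range (suc s) m                ≡⟨ cong (range (suc s)) (sym (+-identityʳ m)) ⟩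
  range (suc s) (m + 0)          ∎
  where open StarReasoning (Rearr c)
grow-right {c} (B ∷ R) s m c≤m (B↭ , cons) (b≤c ∷ bounded) = begin
  range (suc s) m ++ B ++ concat R            ⟶⟨ absorb-right s (concat R) b≤c c≤m B↭ ⟩
  range (suc s) (m + b) ++ concat R           ⟶*⟨ grow-right R s (m + b) (≤-trans c≤m (m≤m+n m b)) cons′ bounded ⟩
  range (suc s) (m + b + length (concat R))   ≡⟨ cong (range (suc s)) (trans (+-assoc m b _) (cong (m +_) (sym (length-++ B)))) ⟩
  range (suc s) (m + length (B ++ concat R))  ∎
  where
  open StarReasoning (Rearr c)
  b = length B
  cons′ : Consecutive (suc s + (m + b)) R
  cons′ = subst (λ t → Consecutive t R) (+-assoc (suc s) m b) cons

grow-left : ∀ {c} L s m → c ≤ m → Consecutive (suc s) L → All (λ B → length B ≤ c) L →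
            SEquiv c (concat L ++ range (suc s + length (concat L)) m) (range (suc s) (length (concat L) + m))
grow-left {c} [] s m _ _ _ = begin
  range (suc s + 0) m            ≡⟨ cong (λ t → range t m) (+-identityʳ (suc s)) ⟩
  range (suc s) m                ∎
  where open StarReasoning (Rearr c)
grow-left {c} (B ∷ L) s m c≤m (B↭ , cons) (b≤c ∷ bounded) = begin
  (B ++ concat L) ++ range (suc s + length (B ++ concat L)) m  ≡⟨ trans (++-assoc B _ _) (cong (λ t → B ++ concat L ++ range t m) start≡) ⟩
  B ++ concat L ++ range (suc (s + b) + a) m                   ⟶*⟨ SEquiv-prefix B (grow-left L (s + b) m c≤m cons bounded) ⟩
  B ++ range (suc (s + b)) (a + m)                             ⟶⟨ absorb-left s b≤c (≤-trans c≤m (m≤n+m m a)) B↭ ⟩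
  range (suc s) (b + (a + m))                                  ≡⟨ cong (range (suc s)) (trans (sym (+-assoc b a m)) (cong (_+ m) (sym (length-++ B)))) ⟩
  range (suc s) (length (B ++ concat L) + m)                   ∎
  where
  open StarReasoning (Rearr c)
  b = length B
  a = length (concat L)
  start≡ : suc s + length (B ++ concat L) ≡ suc (s + b) + a
  start≡ = trans (cong (suc s +_) (length-++ B)) (sym (+-assoc (suc s) b a))

sort-and-grow : ∀ {c} L M R → Consecutive 1 (L ++ M ++ R) → All (λ B → length B ≤ c) (L ++ M ++ R) →
                length (concat M) ≡ c → SEquiv c (concat (L ++ M ++ R)) (range 1 (length (concat (L ++ M ++ R))))
sort-and-grow {c} L M R cons bounded refl = begin
  concat (L ++ M ++ R)                               ≡⟨ concat-++₃ L M R ⟩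
  concat L ++ concat M ++ concat R                   ⟶⟨ sort-window a (concat L) (concat R) M↭ ⟩
  concat L ++ range (suc a) c ++ concat R            ⟶*⟨ SEquiv-prefix (concat L) (grow-right R a c ≤-refl cons-R (All.++⁻ʳ M bounded-MR)) ⟩
  concat L ++ range (suc a) (c + length (concat R))  ⟶*⟨ grow-left L 0 (c + length (concat R)) (m≤m+n c _) cons-L (All.++⁻ˡ L bounded) ⟩
  range 1 (a + (c + length (concat R)))              ≡⟨ cong (range 1) length≡ ⟩
  range 1 (length (concat (L ++ M ++ R)))            ∎
  where
  open StarReasoning (Rearr c)
  a = length (concat L)
  length≡ : a + (c + length (concat R)) ≡ length (concat (L ++ M ++ R))
  length≡ = sym (trans (cong length (concat-++₃ L M R)) (trans (length-++ (concat L)) (cong (a +_) (length-++ (concat M)))))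
  cons-L = proj₁ (consecutive-++⁻ L 1 cons)
  cons-MR = proj₂ (consecutive-++⁻ L 1 cons)
  M↭ : concat M ↭ range (suc a) c
  M↭ = consecutive⇒↭ M (suc a) (proj₁ (consecutive-++⁻ M (suc a) cons-MR))
  cons-R : Consecutive (suc a + c) R
  cons-R = proj₂ (consecutive-++⁻ M (suc a) cons-MR)
  bounded-MR = All.++⁻ʳ L bounded

toothed⇒SEquiv : ∀ {c n w} → InS n w → Toothed c w → SEquiv c w (idWord n)
toothed⇒SEquiv {c} {n} {w} w↭id (bs , blocks , bounded , i , t , |M|≡c)
  with Blocks⇒decomposition (Unique-resp-↭ (↭-sym w↭id) (Unique-idWord n)) blocks
... | refl , asc , _ = subst₂ (SEquiv c) (cong concat (sym bs≡)) range≡id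
  (sort-and-grow L M R (subst (Consecutive 1) bs≡ cons) (subst (All (λ B → length B ≤ c)) bs≡ bounded)
                       (trans (sym (sum-map-length M)) |M|≡c))
  where
  L = take i bs
  M = take t (drop i bs)
  R = drop t (drop i bs)
  bs≡ : bs ≡ L ++ M ++ R
  bs≡ = sym (trans (cong (L ++_) (take++drop≡id t (drop i bs))) (take++drop≡id i bs))
  |w|≡n : length (concat bs) ≡ n
  |w|≡n = trans (↭-length w↭id) (length-idWord n)
  cons : Consecutive 1 bs
  cons = ascending⇒consecutive bs 1 asc (↭-trans w↭id (↭-reflexive (trans (idWord≡range n) (cong (range 1) (sym |w|≡n)))))
  range≡id : range 1 (length (concat (L ++ M ++ R))) ≡ idWord n
  range≡id = trans (cong (λ v → range 1 (length (concat v))) (sym bs≡)) (trans (cong (range 1) |w|≡n) (sym (idWord≡range n)))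

-- Rearranging a hit preserves toothedness

block-too-long : ∀ {c} (x : ℕ) (X Z : List ℕ) → length ((x ∷ X) ++ Z) ≤ c → ¬ c ≤ length Z
block-too-long {c} x X Z |B|≤c c≤|Z| =
  n≮n c (≤-trans (s≤s (≤-trans c≤|Z| (m≤n+m _ (length X)))) (≤-trans (≤-reflexive (sym (length-++ (x ∷ X)))) |B|≤c))

-- A block straddling the start of the window h either contains all of h (too long), or ends inside h;
-- then a letter of h after the block lies above the block, and convexity of h puts every letter of the
-- block that exceeds a letter of h into h itself.
cut-before-window : ∀ {c} bs {p h s} → BlockDecomposition (p ++ h ++ s) bs → All (λ B → length B ≤ c) bs →
  Disjoint p h → Convex h → length h ≡ c →
  ∃₂ λ bs₁ bs₂ → bs ≡ bs₁ ++ bs₂ × BlockDecomposition p bs₁ × BlockDecomposition (h ++ s) bs₂ × p ≪ h ++ s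
cut-before-window {c} bs {p} {h} {s} D bounded p#h convex |h|≡c = decomposition-cut bs D no-straddle
  where
  no-straddle : ∀ {x X y Y R} → (x ∷ X) ++ y ∷ Y ∈ bs → (x ∷ X) ++ y ∷ Y ≪ R → x ∷ X ⊆ p →
                (y ∷ Y) ++ R ≡ h ++ s → x ∷ X ≪ y ∷ Y
  no-straddle {x} {X} {y} {Y} {R} B∈ B≪R X⊆p eq with ++≡++-cases (y ∷ Y) R h s eq
  ... | inj₂ (q , Q , Y≡ , _) = ⊥-elim (block-too-long x X (y ∷ Y) (All.lookup bounded B∈)
          (subst (c ≤_) (cong length (sym Y≡)) (≤-trans (≤-reflexive (sym |h|≡c)) (length-++-≤ˡ h))))
  ... | inj₁ ([] , h≡ , _) = ⊥-elim (block-too-long x X (y ∷ Y) (All.lookup bounded B∈)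
          (≤-reflexive (trans (sym |h|≡c) (cong length (trans h≡ (++-identityʳ (y ∷ Y)))))))
  ... | inj₁ (r ∷ Q , h≡ , R≡) = ≯⇒≪ (λ (v∈X , v∈Y) → p#h (X⊆p v∈X , Y⊆h v∈Y)) λ x′∈ y′∈ y′<x′ →
          p#h (X⊆p x′∈ , convex (Y⊆h y′∈) r∈h (<⇒≤ y′<x′) (<⇒≤ (B≪R (∈-++⁺ˡ x′∈) r∈R)))
    where
    Y⊆h : y ∷ Y ⊆ h
    Y⊆h = ⊆-trans (xs⊆xs++ys _ _) (⊆-reflexive (sym h≡))
    r∈h : r ∈ h
    r∈h = subst (r ∈_) (sym h≡) (∈-++⁺ʳ (y ∷ Y) (here refl))
    r∈R : r ∈ R
    r∈R = subst (r ∈_) (sym R≡) (here refl)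

-- The first block lies inside the window h (it cannot contain all of h), and its first letter is
-- below every later letter; by convexity no letter after h can then be below a letter of h.
window-≪-rest : ∀ {c} bs {h s} → 1 ≤ c → BlockDecomposition (h ++ s) bs → All (λ B → length B ≤ c) bs →
                Disjoint h s → Convex h → length h ≡ c → h ≪ s
window-≪-rest [] {[]} () _ _ _ _ refl
window-≪-rest ([] ∷ bs) _ (_ , _ , (() , _) ∷ _) _ _ _ _
window-≪-rest {c} ((b ∷ B) ∷ bs) {h} {s} _ (eq , (B≪ , _) , _) (|B|≤c ∷ _) h#s convex |h|≡c
  with ++≡++-cases (b ∷ B) (concat bs) h s eq
... | inj₂ (q , Q , B≡ , _) = ⊥-elim (n≮n c (≤-trans c<|B| |B|≤c))
  where
  c<|B| : c < length (b ∷ B)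
  c<|B| = subst₂ _<_ |h|≡c (trans (sym (length-++ h)) (cong length (sym B≡))) (m<m+n (length h) (s≤s z≤n))
... | inj₁ (Q , h≡ , bs≡) = ≯⇒≪ h#s λ x∈ y∈ y<x →
  h#s (convex (subst (b ∈_) (sym h≡) (here refl)) x∈
              (<⇒≤ (B≪ (here refl) (subst (_ ∈_) (sym bs≡) (∈-++⁺ʳ Q y∈)))) (<⇒≤ y<x) , y∈)

toothed-at-window : ∀ {c p h s bs₁ bsₕ bs₂} →
  BlockDecomposition p bs₁ → BlockDecomposition h bsₕ → BlockDecomposition s bs₂ → p ≪ h ++ s → h ≪ s →
  All (λ B → length B ≤ c) bs₁ → All (λ B → length B ≤ c) bs₂ → length h ≡ c → Toothed c (p ++ h ++ s)
toothed-at-window {c} {bs₁ = bs₁} {bsₕ} {bs₂} D₁ Dₕ@(refl , _) D₂ p≪hs h≪s bounded₁ bounded₂ refl =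
  bs₁ ++ bsₕ ++ bs₂ ,
  decomposition⇒Blocks _ (decomposition-++ D₁ (decomposition-++ Dₕ D₂ h≪s) p≪hs) ,
  All.++⁺ bounded₁ (All.++⁺ (All.tabulate length≤length-concat) bounded₂) ,
  length bs₁ , length bsₕ , teeth
  where
  open ≡-Reasoning
  teeth : sum (map length (take (length bsₕ) (drop (length bs₁) (bs₁ ++ bsₕ ++ bs₂)))) ≡ length (concat bsₕ)
  teeth = begin
    sum (map length (take (length bsₕ) (drop (length bs₁) (bs₁ ++ bsₕ ++ bs₂))))
      ≡⟨ cong (λ v → sum (map length (take (length bsₕ) v))) (drop-length-++ bs₁ _) ⟩
    sum (map length (take (length bsₕ) (bsₕ ++ bs₂)))
      ≡⟨ cong (λ v → sum (map length v)) (take-length-++ bsₕ bs₂) ⟩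
    sum (map length bsₕ)
      ≡⟨ sum-map-length bsₕ ⟩
    length (concat bsₕ)
      ∎

toothed-rearrange-window : ∀ {c p h h′ s} → 1 ≤ c → Unique (p ++ h′ ++ s) → Unique h → h′ ↭ h →
                           Convex h′ → length h′ ≡ c → Toothed c (p ++ h′ ++ s) → Toothed c (p ++ h ++ s)
toothed-rearrange-window {c} {p} {h} {h′} {s} 1≤c u′ uₕ h′↭h convex′ |h′|≡c (bs , blocks , bounded , _)
  with Unique-++⁻ p u′
... | _ , u-h′s , p#h′s
  with cut-before-window bs (Blocks⇒decomposition u′ blocks) bounded (λ (v∈p , v∈h′) → p#h′s (v∈p , ∈-++⁺ˡ v∈h′))
                         convex′ |h′|≡c
... | bs₁ , bs₂ , refl , D₁ , D₂ , p≪h′s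
  with window-≪-rest bs₂ 1≤c D₂ (All.++⁻ʳ bs₁ bounded) (proj₂ (proj₂ (Unique-++⁻ h′ u-h′s))) convex′ |h′|≡c
... | h′≪s
  with cut-between bs₂ h′≪s D₂ | Blocks-exist h
... | bs₃ , bs₄ , refl , _ , D₄ | bsₕ , blocksₕ =
  toothed-at-window D₁ (Blocks⇒decomposition uₕ blocksₕ) D₄
    (≪-mono ⊆-refl (⊆-reflexive-↭ (++⁺ʳ s (↭-sym h′↭h))) p≪h′s) (≪-mono (⊆-reflexive-↭ (↭-sym h′↭h)) ⊆-refl h′≪s)
    (All.++⁻ˡ bs₁ bounded) (All.++⁻ʳ bs₃ (All.++⁻ʳ bs₁ bounded)) (trans (sym (↭-length h′↭h)) |h′|≡c)

Rearr-reflects-toothed : ∀ {c u v} → 1 ≤ c → Rearr c u v → Unique u → Toothed c v → Toothed c u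
Rearr-reflects-toothed 1≤c r@(rearr p h h′ s hit@(|h|≡c , _) h′↭h) u =
  toothed-rearrange-window {p = p} {s = s} 1≤c (Unique-resp-Rearr r u) (proj₁ (Unique-++⁻ h (proj₁ (proj₂ (Unique-++⁻ p u)))))
    h′↭h (Convex-resp-↭ (↭-sym h′↭h) (hit-convex hit)) (trans (↭-length h′↭h) |h|≡c)

SEquiv-reflects-toothed : ∀ {c u v} → 1 ≤ c → SEquiv c u v → Unique u → Toothed c v → Toothed c u
SEquiv-reflects-toothed 1≤c ε        _ = λ t → t
SEquiv-reflects-toothed 1≤c (r ◅ rs) u =
  Rearr-reflects-toothed 1≤c r u ∘′ SEquiv-reflects-toothed 1≤c rs (Unique-resp-Rearr r u)

singletons-decomposition : ∀ s m → BlockDecomposition (range s m) (map [_] (range s m))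
singletons-decomposition s zero    = refl , tt , []
singletons-decomposition s (suc m) with singletons-decomposition (suc s) m
... | concat≡ , asc , irrs = cong (s ∷_) concat≡ , (s≪ , asc) , singleton-irreducible ∷ irrs
  where
  s≪ : [ s ] ≪ concat (map [_] (range (suc s) m))
  s≪ (here refl) y∈ = proj₁ (∈-range⁻ (suc s) m (subst (_ ∈_) concat≡ y∈))
  singleton-irreducible : Irreducible [ s ]
  singleton-irreducible = s≤s z≤n , λ j 1≤j j<1 _ → n≮n 1 (≤-<-trans 1≤j j<1)

idWord-toothed : ∀ {c n} → 1 ≤ c → c ≤ n → Toothed c (idWord n)
idWord-toothed {c} {n} 1≤c c≤n =
  map [_] (range 1 n) ,
  subst (λ v → Blocks v (map [_] (range 1 n))) (sym (idWord≡range n)) (decomposition⇒Blocks _ (singletons-decomposition 1 n)) ,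
  All.map⁺ (All.universal (λ _ → 1≤c) (range 1 n)) ,
  0 , c , teeth
  where
  open ≡-Reasoning
  teeth : sum (map length (take c (map [_] (range 1 n)))) ≡ c
  teeth = begin
    sum (map length (take c (map [_] (range 1 n))))   ≡⟨ sum-map-length (take c (map [_] (range 1 n))) ⟩
    length (concat (take c (map [_] (range 1 n))))     ≡⟨ cong (λ v → length (concat v)) (take-map c (range 1 n)) ⟩
    length (concat (map [_] (take c (range 1 n))))     ≡⟨ cong length (concat-map-[_] (take c (range 1 n))) ⟩
    length (take c (range 1 n))                         ≡⟨ length-take c (range 1 n) ⟩
    c ⊓ length (range 1 n)                              ≡⟨ m≤n⇒m⊓n≡m (subst (c ≤_) (sym (length-range 1 n)) c≤n) ⟩
    c                                                   ∎

theorem4p5 : ∀ (c n : ℕ) → 1 ≤ c → c ≤ n → (w : List ℕ) → InS n w →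
             (SEquiv c w (idWord n) ⇔ Toothed c w)
theorem4p5 c n 1≤c c≤n w w↭id = mk⇔
  (λ w~id → SEquiv-reflects-toothed 1≤c w~id (Unique-resp-↭ (↭-sym w↭id) (Unique-idWord n)) (idWord-toothed 1≤c c≤n))
  (toothed⇒SEquiv w↭id)
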